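{- Let $\mathcal{F} \subset \mathcal{P}([n])$ be an $r$-closed $\theta$-intersecting family, where $r \geq 3$ and $\theta \in (0,1)$. Then $\mathcal{F}_{\mathrm{nor}}^{*}$ is $s$-closed $\theta$-intersecting for all $s \geq 2$.
   Context: For an integer $s \geq 2$, a family $\mathcal{G} \subset \mathcal{P}([n])$ is $s$-closed $\theta$-intersecting if for each $2 \leq t \leq s$ and any $t$ distinct sets $A_1,\dots,A_t \in \mathcal{G}$ we have $|A_1 \cap \dots \cap A_t| \in \{\theta|A_1|, \dots, \theta|A_t|\}$. $\mathcal{F}(i) := \mathcal{F} \cap \binom{[n]}{i}$. For $A \in \mathcal{F}$, $\mathrm{Tor}(A) := \{B \in \mathcal{F} : |B| \geq |A|,\ |A \cap B| = \theta|A|\}$. When $\mathrm{Tor}(A) \neq \emptyset$, $\mathrm{core}(A) := A \cap B$ for any $B \in \mathrm{Tor}(A)$ (independent of the choice of $B$), and $\mathrm{petal}(A) := A \setminus \mathrm{core}(A)$. $S := \{i \in [n] : \mathcal{F}(i) \neq \emptyset\}$, $S_{\mathrm{nor}} := \{i \in S : \mathrm{Tor}(A) \neq \emptyset \text{ for all } A \in \mathcal{F}(i)\}$, $i_{\max} := \max S_{\mathrm{nor}}$, and $\mathcal{F}_{\mathrm{nor}} := \bigcup_{i \in S_{\mathrm{nor}}} \mathcal{F}(i)$. There is at most one set $A \in \mathcal{F}_{\mathrm{nor}}$ for which there exists $B \in \mathcal{F}(i_{\max})$ with $\mathrm{petal}(A) \cap \mathrm{core}(B) \neq \emptyset$; when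 it exists it is denoted $E_{\mathrm{nor}}$. Define $\mathcal{F}_{\mathrm{nor}}^{*} := \mathcal{F}_{\mathrm{nor}} \setminus \{E_{\mathrm{nor}}\}$ (so $\mathcal{F}_{\mathrm{nor}}^{*} = \mathcal{F}_{\mathrm{nor}}$ if $E_{\mathrm{nor}}$ does not exist).
   Formalization: The parameter θ ranges over the rationals in (0,1) rather than the reals. -}

module Defs where

open import Data.Nat using (ℕ; _≤_)
open import Data.Fin using (Fin)
open import Data.Fin.Subset using (Subset; _∩_; _─_; ⋂; ∣_∣; Nonempty)
open import Data.Integer using (+_)
open import Data.Rational using (ℚ; _/_; _*_)
open import Data.List using (tabulate)
open import Data.Bool using (Bool; T)
open import Data.Product using (Σ; _×_; ∃)
open import Relation.Nullary using (¬_)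
open import Relation.Binary.PropositionalEquality using (_≡_)
open import Function.Definitions using (Injective)

ℕtoℚ : ℕ → ℚ
ℕtoℚ k = + k / 1

θ·∣_∣ : ℚ → ∀ {n} → Subset n → ℚ
θ·∣ θ ∣ A = θ * ℕtoℚ ∣ A ∣

⋂ᶠ : ∀ {n t} → (Fin t → Subset n) → Subset n
⋂ᶠ A = ⋂ (tabulate A)

ClosedIntersecting : ∀ {n} → ℕ → ℚ → (Subset n → Set) → Set
ClosedIntersecting {n} s θ G =
  ∀ (t : ℕ) → 2 ≤ t → t ≤ s →
  ∀ (A : Fin t → Subset n) → Injective _≡_ _≡_ A → (∀ i → G (A i)) →
  ∃ λ (i : Fin t) → ℕtoℚ ∣ ⋂ᶠ A ∣ ≡ θ·∣ θ ∣ (A i)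

module _ {n : ℕ} (𝓕 : Subset n → Bool) (θ : ℚ) where

  In : Subset n → Set
  In A = T (𝓕 A)

  InTor : Subset n → Subset n → Set
  InTor A B = In B × ∣ A ∣ ≤ ∣ B ∣ × ℕtoℚ ∣ A ∩ B ∣ ≡ θ·∣ θ ∣ A

  -- C = core(A) : C = A ∩ B for some B ∈ Tor(A)
  -- (the paper shows this is independent of the choice of B)
  IsCore : Subset n → Subset n → Set
  IsCore A C = ∃ λ B → InTor A B × C ≡ A ∩ B

  IsPetal : Subset n → Subset n → Set
  IsPetal A P = ∃ λ C → IsCore A C × P ≡ A ─ C

  InSnor : ℕ → Set
  InSnor i = (∃ λ A → In A × ∣ A ∣ ≡ i)
           × (∀ A → In A → ∣ A ∣ ≡ i → ∃ λ B → InTor A B)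

  IsImax : ℕ → Set
  IsImax i = InSnor i × (∀ j → InSnor j → j ≤ i)

  InFnor : Subset n → Set
  InFnor A = In A × InSnor ∣ A ∣

  -- A ∈ 𝓕_nor and there is B ∈ 𝓕(i_max) with petal(A) ∩ core(B) ≠ ∅,
  -- i.e. A = E_nor (the paper shows there is at most one such A)
  IsEnor : Subset n → Set
  IsEnor A = InFnor A × ∃ λ B → In B × IsImax ∣ B ∣ ×
             ∃ λ P → ∃ λ C → IsPetal A P × IsCore B C × Nonempty (P ∩ C)

  InFnor* : Subset n → Set
  InFnor* A = InFnor A × ¬ IsEnor A

-- Let a be a smallest of the distinct sets A₁, …, A_t and U a Tor-partner of a, so that
-- the core C = a ∩ U has θ|a| elements. The three-set condition for a, B, U forces
-- a ∩ B ∩ U = C, so C ⊆ B for every other member B with |B| ≥ |a|; in particular C lies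
-- in every A_k. Now intersect the A_k one at a time into A_j ∩ a (with A_j ≠ a). Each
-- partial intersection X either has θ|a| elements, and then so does every further one,
-- being squeezed between C and X; or X = A_j ∩ a with θ|A_j| elements for some A_j ≠ a,
-- and the conditions on the triple A_k, A_j, a and the pair A_k, a show that A_k ∩ X is
-- again of one of these two forms.
module Submission where

open import Defs
open import Data.Nat using (ℕ; _≤_)
open import Data.Fin.Subset using (Subset)
open import Data.Bool using (Bool; T)
open import Data.Rational using (ℚ; 0ℚ; 1ℚ; _<_)

open import Data.Nat as ℕ using (zero; suc)
import Data.Nat.Properties as ℕ
import Data.Nat.Coprimality as Coprime
open import Data.Integer as ℤ using (+_)
import Data.Integer.Properties as ℤ
open import Data.Rational as ℚ using (mkℚ; _*_; ↥_; *≤*)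
import Data.Rational.Properties as ℚ
open import Data.Fin using (Fin; zero; suc)
open import Data.Fin.Subset using (_∩_; _⊆_; _-_; ∣_∣; ⊥; ⋂)
open import Data.Fin.Subset.Properties
open import Data.List as List using (List; foldr; tabulate; allFin)
open import Data.Vec.Functional using ([]; _∷_)
open import Function using (_∘_; id)
open import Relation.Nullary using (yes; no)
open import Relation.Binary.Definitions using (DecidableEquality)
open import Function.Definitions using (Injective)
open import Data.Vec.Properties using (≡-dec)
import Data.Bool as Bool
import Data.List.Relation.Unary.All.Properties as All
open import Data.List.Extrema.Nat using (argmin; f[argmin]≤f[xs])
open import Data.Fin using (punchIn)
open import Data.Fin.Properties using (punchInᵢ≢i)
open import Data.Product using (_×_; _,_; ∃; proj₁; proj₂; map₂)
open import Data.Sum using (_⊎_; inj₁; inj₂; [_,_]′)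
open import Data.Empty using (⊥-elim)
open import Relation.Binary.PropositionalEquality

private
  variable
    n m k t : ℕ
    p q r Z : Subset n

ℕtoℚ≡mkℚ : ∀ k → ℕtoℚ k ≡ mkℚ (+ k) 0 (Coprime.sym (Coprime.1-coprimeTo k))
ℕtoℚ≡mkℚ k = ℚ.normalize-coprime (Coprime.sym (Coprime.1-coprimeTo k))

ℕtoℚ-injective : ℕtoℚ m ≡ ℕtoℚ k → m ≡ k
ℕtoℚ-injective {m} {k} eq rewrite ℕtoℚ≡mkℚ m | ℕtoℚ≡mkℚ k = ℤ.+-injective (cong ↥_ eq)

ℕtoℚ-mono-≤ : m ≤ k → ℕtoℚ m ℚ.≤ ℕtoℚ k
ℕtoℚ-mono-≤ {m} {k} m≤k rewrite ℕtoℚ≡mkℚ m | ℕtoℚ≡mkℚ k =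
  *≤* (subst₂ ℤ._≤_ (sym (ℤ.*-identityʳ (+ m))) (sym (ℤ.*-identityʳ (+ k))) (ℤ.+≤+ m≤k))

ℕtoℚ-cancel-≤ : ℕtoℚ m ℚ.≤ ℕtoℚ k → m ≤ k
ℕtoℚ-cancel-≤ {m} {k} m≤k rewrite ℕtoℚ≡mkℚ m | ℕtoℚ≡mkℚ k =
  ℤ.drop‿+≤+ (subst₂ ℤ._≤_ (ℤ.*-identityʳ (+ m)) (ℤ.*-identityʳ (+ k)) (ℚ.drop-*≤* m≤k))

θ*-fixedPoint⇒0 : ∀ {θ} → θ < 1ℚ → θ * ℕtoℚ k ≡ ℕtoℚ k → k ≡ 0
θ*-fixedPoint⇒0 {zero}  θ<1 eq = refl
θ*-fixedPoint⇒0 {suc k} {θ} θ<1 eq = ⊥-elim (ℚ.<-irrefl (trans eq (sym (ℚ.*-identityˡ x))) θx<x)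
  where
  x : ℚ
  x = ℕtoℚ (suc k)
  instance
    x-positive : ℚ.Positive x
    x-positive rewrite ℕtoℚ≡mkℚ (suc k) = _
  θx<x : θ * x < 1ℚ * x
  θx<x = ℚ.*-monoˡ-<-pos x θ<1

⊆-∩ : r ⊆ p → r ⊆ q → r ⊆ p ∩ q
⊆-∩ r⊆p r⊆q x∈r = x∈p∩q⁺ (r⊆p x∈r , r⊆q x∈r)

p⊆q⇒p∩q≡p : p ⊆ q → p ∩ q ≡ p
p⊆q⇒p∩q≡p {p = p} {q} p⊆q = ⊆-antisym (p∩q⊆p p q) (⊆-∩ ⊆-refl p⊆q)

p⊆q∧∣q∣≤∣p∣⇒p≡q : p ⊆ q → ∣ q ∣ ≤ ∣ p ∣ → p ≡ q
p⊆q∧∣q∣≤∣p∣⇒p≡q {p = p} {q} p⊆q ∣q∣≤∣p∣ = ⊆-antisym p⊆q q⊆p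
  where
  q⊆p : q ⊆ p
  q⊆p {x} x∈q with x ∈? p
  ... | yes x∈p = x∈p
  ... | no  x∉p = ⊥-elim (ℕ.<-irrefl refl (begin-strict
    ∣ q ∣     ≤⟨ ∣q∣≤∣p∣ ⟩
    ∣ p ∣     ≤⟨ p⊆q⇒∣p∣≤∣q∣ p⊆q-x ⟩
    ∣ q - x ∣ <⟨ x∈p⇒∣p-x∣<∣p∣ x∈q ⟩
    ∣ q ∣     ∎))
    where
    open ℕ.≤-Reasoning
    p⊆q-x : p ⊆ q - x
    p⊆q-x y∈p = x∈p∧x≢y⇒x∈p-y (p⊆q y∈p) (λ { refl → x∉p y∈p })

p∩[q∩r]⊆p∩r : ∀ (p q r : Subset n) → p ∩ (q ∩ r) ⊆ p ∩ r
p∩[q∩r]⊆p∩r p q r = ⊆-∩ (p∩q⊆p p (q ∩ r)) (⊆-trans (p∩q⊆q p (q ∩ r)) (p∩q⊆q q r))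

∣p∣≡0⇒p≡⊥ : ∣ p ∣ ≡ 0 → p ≡ ⊥
∣p∣≡0⇒p≡⊥ {n} {p} ∣p∣≡0 =
  sym (p⊆q∧∣q∣≤∣p∣⇒p≡q ⊥⊆ (subst (_≤ ∣ ⊥ {n} ∣) (sym ∣p∣≡0) ℕ.z≤n))

⋂ᶠ-⊆ : (A : Fin t → Subset n) (i : Fin t) → ⋂ᶠ A ⊆ A i
⋂ᶠ-⊆ A zero    = p∩q⊆p _ _
⋂ᶠ-⊆ A (suc i) = ⊆-trans (p∩q⊆q _ _) (⋂ᶠ-⊆ (A ∘ suc) i)

⋂ᶠ-pair : ∀ (p q : Subset n) → ⋂ᶠ (p ∷ q ∷ []) ≡ p ∩ q
⋂ᶠ-pair p q = cong (p ∩_) (∩-identityʳ q)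

⋂ᶠ-triple : ∀ (p q r : Subset n) → ⋂ᶠ (p ∷ q ∷ r ∷ []) ≡ p ∩ (q ∩ r)
⋂ᶠ-triple p q r = cong (λ X → p ∩ (q ∩ X)) (∩-identityʳ r)

foldr-∩ : (ps : List (Subset n)) → foldr _∩_ q ps ≡ ⋂ ps ∩ q
foldr-∩ {q = q} List.[]         = sym (∩-identityˡ q)
foldr-∩ {q = q} (p List.∷ ps) = trans (cong (p ∩_) (foldr-∩ ps)) (sym (∩-assoc p (⋂ ps) q))

_≟_ : DecidableEquality (Subset n)
_≟_ = ≡-dec Bool._≟_

argmin-Fin : (f : Fin (suc t) → ℕ) → ∃ λ i → ∀ k → f i ≤ f k
argmin-Fin {t} f =
  argmin f zero (allFin (suc t)) , All.tabulate⁻ {f = id} (f[argmin]≤f[xs] {f = f} zero (allFin (suc t)))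

[]-injective : ∀ {A : Set} → Injective _≡_ _≡_ ([] {A = A})
[]-injective {x = ()}

∷-injective : ∀ {A : Set} {x : A} {xs : Fin t → A} →
              (∀ i → x ≢ xs i) → Injective _≡_ _≡_ xs → Injective _≡_ _≡_ (x ∷ xs)
∷-injective x∉xs xs-inj {zero}  {zero}  _  = refl
∷-injective x∉xs xs-inj {zero}  {suc j} eq = ⊥-elim (x∉xs j eq)
∷-injective x∉xs xs-inj {suc i} {zero}  eq = ⊥-elim (x∉xs i (sym eq))
∷-injective x∉xs xs-inj {suc i} {suc j} eq = cong suc (xs-inj eq)

-- A record rather than a synonym for the equation, so that unifying two instances
-- compares the sets involved instead of normalising ℕtoℚ.
infix 4 _≐_·∣_∣
record _≐_·∣_∣ {n : ℕ} (Z : Subset n) (θ : ℚ) (X : Subset n) : Set where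
  constructor ≐⁺
  field ≐⁻ : ℕtoℚ ∣ Z ∣ ≡ θ·∣ θ ∣ X
open _≐_·∣_∣

module _ {θ : ℚ} where

  ≐-squeeze : r ⊆ q → q ⊆ p → r ≐ θ ·∣ Z ∣ → p ≐ θ ·∣ Z ∣ → q ≐ θ ·∣ Z ∣
  ≐-squeeze {r = r} {q = q} {p = p} r⊆q q⊆p (≐⁺ r≐) (≐⁺ p≐) = ≐⁺ (trans (cong ℕtoℚ ∣q∣≡∣p∣) p≐)
    where
    ∣r∣≡∣p∣ : ∣ r ∣ ≡ ∣ p ∣
    ∣r∣≡∣p∣ = ℕtoℚ-injective (trans r≐ (sym p≐))
    ∣q∣≡∣p∣ : ∣ q ∣ ≡ ∣ p ∣
    ∣q∣≡∣p∣ = ℕ.≤-antisym (p⊆q⇒∣p∣≤∣q∣ q⊆p) (subst (_≤ ∣ q ∣) ∣r∣≡∣p∣ (p⊆q⇒∣p∣≤∣q∣ r⊆q))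

  ≐-⊆⇒≡ : p ⊆ q → p ≐ θ ·∣ Z ∣ → q ≐ θ ·∣ Z ∣ → p ≡ q
  ≐-⊆⇒≡ p⊆q (≐⁺ p≐) (≐⁺ q≐) = p⊆q∧∣q∣≤∣p∣⇒p≡q p⊆q (ℕ.≤-reflexive (ℕtoℚ-injective (trans q≐ (sym p≐))))

  ≐-lowerBound : 0ℚ < θ → ∣ p ∣ ≤ ∣ q ∣ → r ≐ θ ·∣ p ∣ → Z ≐ θ ·∣ q ∣ → ∣ r ∣ ≤ ∣ Z ∣
  ≐-lowerBound {p = p} {q = q} {r = r} {Z = Z} 0<θ p≤q (≐⁺ r≐) (≐⁺ Z≐) = ℕtoℚ-cancel-≤ (begin
    ℕtoℚ ∣ r ∣        ≡⟨ r≐ ⟩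
    θ * ℕtoℚ ∣ p ∣    ≤⟨ ℚ.*-monoˡ-≤-nonNeg θ {{ℚ.pos⇒nonNeg θ {{ℚ.positive 0<θ}}}} (ℕtoℚ-mono-≤ p≤q) ⟩
    θ * ℕtoℚ ∣ q ∣    ≡⟨ sym Z≐ ⟩
    ℕtoℚ ∣ Z ∣        ∎)
    where open ℚ.≤-Reasoning

  ≐-self⇒≡⊥ : θ < 1ℚ → p ≐ θ ·∣ p ∣ → p ≡ ⊥
  ≐-self⇒≡⊥ θ<1 (≐⁺ p≐) = ∣p∣≡0⇒p≡⊥ (θ*-fixedPoint⇒0 θ<1 (sym p≐))

-- ClosedIntersecting s θ G unfolds to a Π-type from which θ and G cannot be inferred,
-- so callers of these lemmas pass them explicitly.
module _ {θ : ℚ} {G : Subset n → Set} where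

  ClosedIntersecting-mono : ∀ {s s′} → s ≤ s′ → ClosedIntersecting s′ θ G → ClosedIntersecting s θ G
  ClosedIntersecting-mono s≤s′ closed t 2≤t t≤s = closed t 2≤t (ℕ.≤-trans t≤s s≤s′)

  ClosedIntersecting-⊆ : ∀ {s} {H : Subset n → Set} → (∀ {A} → H A → G A) →
                         ClosedIntersecting s θ G → ClosedIntersecting s θ H
  ClosedIntersecting-⊆ H⇒G closed t 2≤t t≤s A A-inj A∈H = closed t 2≤t t≤s A A-inj (H⇒G ∘ A∈H)

  PairwiseIntersecting TriplewiseIntersecting : Set
  PairwiseIntersecting = ∀ {p q} → G p → G q → p ≢ q → p ∩ q ≐ θ ·∣ p ∣ ⊎ p ∩ q ≐ θ ·∣ q ∣
  TriplewiseIntersecting = ∀ {p q r} → G p → G q → G r → p ≢ q → p ≢ r → q ≢ r →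
    p ∩ (q ∩ r) ≐ θ ·∣ p ∣ ⊎ p ∩ (q ∩ r) ≐ θ ·∣ q ∣ ⊎ p ∩ (q ∩ r) ≐ θ ·∣ r ∣

  closed-≐ : ∀ {s t} → ClosedIntersecting s θ G → 2 ≤ t → t ≤ s →
             (A : Fin t → Subset n) → Injective _≡_ _≡_ A → (∀ i → G (A i)) →
             ∃ λ i → ⋂ᶠ A ≐ θ ·∣ A i ∣
  closed-≐ {t = t} closed 2≤t t≤s A A-inj A∈G =
    let i , eq = closed t 2≤t t≤s A A-inj A∈G in i , ≐⁺ eq

  closed⇒pairwise : ClosedIntersecting 2 θ G → PairwiseIntersecting
  closed⇒pairwise closed {p} {q} Gp Gq p≢q
    with closed-≐ closed ℕ.≤-refl ℕ.≤-refl (p ∷ q ∷ [])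
                (∷-injective (λ { zero → p≢q }) (∷-injective (λ ()) []-injective))
                (λ { zero → Gp ; (suc zero) → Gq })
  ... | zero     , eq = inj₁ (subst (_≐ θ ·∣ p ∣) (⋂ᶠ-pair p q) eq)
  ... | suc zero , eq = inj₂ (subst (_≐ θ ·∣ q ∣) (⋂ᶠ-pair p q) eq)

  closed⇒triplewise : ClosedIntersecting 3 θ G → TriplewiseIntersecting
  closed⇒triplewise closed {p} {q} {r} Gp Gq Gr p≢q p≢r q≢r
    with closed-≐ closed (ℕ.s≤s (ℕ.s≤s ℕ.z≤n)) ℕ.≤-refl (p ∷ q ∷ r ∷ [])
                (∷-injective (λ { zero → p≢q ; (suc zero) → p≢r })
                  (∷-injective (λ { zero → q≢r }) (∷-injective (λ ()) []-injective)))
                (λ { zero → Gp ; (suc zero) → Gq ; (suc (suc zero)) → Gr })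
  ... | zero           , eq = inj₁ (subst (_≐ θ ·∣ p ∣) (⋂ᶠ-triple p q r) eq)
  ... | suc zero       , eq = inj₂ (inj₁ (subst (_≐ θ ·∣ q ∣) (⋂ᶠ-triple p q r) eq))
  ... | suc (suc zero) , eq = inj₂ (inj₂ (subst (_≐ θ ·∣ r ∣) (⋂ᶠ-triple p q r) eq))

Tor : (Subset n → Set) → ℚ → Subset n → Subset n → Set
Tor G θ A B = G B × ∣ A ∣ ≤ ∣ B ∣ × A ∩ B ≐ θ ·∣ A ∣

HasTorPartner : (Subset n → Set) → ℚ → Subset n → Set
HasTorPartner G θ A = G A × ∃ (Tor G θ A)

module TorPartners {θ : ℚ} (0<θ : 0ℚ < θ) (θ<1 : θ < 1ℚ) {G : Subset n → Set}
                   (pair : PairwiseIntersecting {θ = θ} {G = G})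
                   (triple : TriplewiseIntersecting {θ = θ} {G = G}) where

  core-⊆ : ∀ {a U B} → G a → Tor G θ a U → G B → ∣ a ∣ ≤ ∣ B ∣ → B ≢ a → a ∩ U ⊆ B
  core-⊆ {a} {U} {B} Ga (GU , a≤U , C≐) GB a≤B B≢a with U ≟ B | U ≟ a
  ... | yes refl | _        = p∩q⊆q a U
  ... | no _     | yes refl = ⊆-trans (p∩q⊆p a a) (subst (_⊆ B) (sym a≡⊥) ⊥⊆)
    where
    a≡⊥ : a ≡ ⊥
    a≡⊥ = ≐-self⇒≡⊥ θ<1 (subst (_≐ θ ·∣ a ∣) (∩-idem a) C≐)
  ... | no U≢B   | no U≢a   = subst (_⊆ B) W≡C (⊆-trans (p∩q⊆q a (B ∩ U)) (p∩q⊆p B U))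
    where
    W : Subset n
    W = a ∩ (B ∩ U)
    lowerBound : ∀ {Y} → ∣ a ∣ ≤ ∣ Y ∣ → W ≐ θ ·∣ Y ∣ → ∣ a ∩ U ∣ ≤ ∣ W ∣
    lowerBound a≤Y = ≐-lowerBound 0<θ a≤Y C≐
    W≡C : W ≡ a ∩ U
    W≡C = p⊆q∧∣q∣≤∣p∣⇒p≡q (p∩[q∩r]⊆p∩r a B U)
            ([ lowerBound ℕ.≤-refl , [ lowerBound a≤B , lowerBound a≤U ]′ ]′
               (triple Ga GB GU (≢-sym B≢a) (≢-sym U≢a) (≢-sym U≢B)))

  module Intersection {t} (A : Fin t → Subset n) (A∈G : ∀ k → G (A k))
                      (i : Fin t) (A-min : ∀ k → ∣ A i ∣ ≤ ∣ A k ∣)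
                      {U : Subset n} (tor : Tor G θ (A i) U) where

    a C : Subset n
    a = A i
    C = a ∩ U

    C≐ : C ≐ θ ·∣ a ∣
    C≐ = proj₂ (proj₂ tor)

    C⊆A : ∀ k → C ⊆ A k
    C⊆A k with A k ≟ a
    ... | yes Ak≡a = subst (C ⊆_) (sym Ak≡a) (p∩q⊆p a U)
    ... | no  Ak≢a = core-⊆ (A∈G i) tor (A∈G k) (A-min k) Ak≢a

    C⊆A∩a : ∀ k → C ⊆ A k ∩ a
    C⊆A∩a k = ⊆-∩ (C⊆A k) (p∩q⊆p a U)

    C⊆A∩A∩a : ∀ k j → C ⊆ A k ∩ (A j ∩ a)
    C⊆A∩A∩a k j = ⊆-∩ (C⊆A k) (C⊆A∩a j)

    data Admissible (X : Subset n) : Set where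
      core-sized : C ⊆ X → X ≐ θ ·∣ a ∣ → Admissible X
      pair-sized : ∀ j → A j ≢ a → X ≡ A j ∩ a → X ≐ θ ·∣ A j ∣ → Admissible X

    admissible-pair : ∀ j → A j ≢ a → Admissible (A j ∩ a)
    admissible-pair j Aj≢a with pair (A∈G j) (A∈G i) Aj≢a
    ... | inj₁ Aj∩a≐Aj = pair-sized j Aj≢a refl Aj∩a≐Aj
    ... | inj₂ Aj∩a≐a  = core-sized (C⊆A∩a j) Aj∩a≐a

    admissible-triple : ∀ k j → A j ≢ a → A k ≢ a → A k ≢ A j → A j ∩ a ≐ θ ·∣ A j ∣ →
                        Admissible (A k ∩ (A j ∩ a))
    admissible-triple k j Aj≢a Ak≢a Ak≢Aj Aj∩a≐Aj
      with triple (A∈G k) (A∈G j) (A∈G i) Ak≢Aj Ak≢a Aj≢a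
    ... | inj₂ (inj₂ W≐a)  = core-sized (C⊆A∩A∩a k j) W≐a
    ... | inj₂ (inj₁ W≐Aj) = pair-sized j Aj≢a (≐-⊆⇒≡ (p∩q⊆q (A k) _) W≐Aj Aj∩a≐Aj) W≐Aj
    ... | inj₁ W≐Ak with pair (A∈G k) (A∈G i) Ak≢a
    ...   | inj₁ Ak∩a≐Ak = pair-sized k Ak≢a (≐-⊆⇒≡ (p∩[q∩r]⊆p∩r (A k) (A j) a) W≐Ak Ak∩a≐Ak) W≐Ak
    ...   | inj₂ Ak∩a≐a  =
      core-sized (C⊆A∩A∩a k j) (≐-squeeze (C⊆A∩A∩a k j) (p∩[q∩r]⊆p∩r (A k) (A j) a) C≐ Ak∩a≐a)

    admissible-absorb : ∀ {X} k → X ⊆ A k → Admissible X → Admissible (A k ∩ X)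
    admissible-absorb k X⊆Ak = subst Admissible (sym (trans (∩-comm _ _) (p⊆q⇒p∩q≡p X⊆Ak)))

    admissible-∩ : ∀ {X} k → Admissible X → Admissible (A k ∩ X)
    admissible-∩ {X} k (core-sized C⊆X X≐a) =
      core-sized C⊆Ak∩X (≐-squeeze C⊆Ak∩X (p∩q⊆q (A k) X) C≐ X≐a)
      where
      C⊆Ak∩X : C ⊆ A k ∩ X
      C⊆Ak∩X = ⊆-∩ (C⊆A k) C⊆X
    admissible-∩ k adm@(pair-sized j Aj≢a refl X≐Aj) with A k ≟ a | A k ≟ A j
    ... | yes Ak≡a | _         = admissible-absorb k (subst (A j ∩ a ⊆_) (sym Ak≡a) (p∩q⊆q (A j) a)) adm
    ... | no  _    | yes Ak≡Aj = admissible-absorb k (subst (A j ∩ a ⊆_) (sym Ak≡Aj) (p∩q⊆p (A j) a)) adm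
    ... | no Ak≢a  | no Ak≢Aj  = admissible-triple k j Aj≢a Ak≢a Ak≢Aj X≐Aj

    admissible-foldr : ∀ {s X} (f : Fin s → Fin t) → Admissible X →
                       Admissible (foldr _∩_ X (tabulate (A ∘ f)))
    admissible-foldr {zero}  f adm = adm
    admissible-foldr {suc s} f adm = admissible-∩ (f zero) (admissible-foldr (f ∘ suc) adm)

    ⋂ᶠ-attained : ∀ j → A j ≢ a → ∃ λ k → ⋂ᶠ A ≐ θ ·∣ A k ∣
    ⋂ᶠ-attained j Aj≢a =
      attained (subst Admissible ⋂ᶠ≡ (admissible-foldr id (admissible-pair j Aj≢a)))
      where
      ⋂ᶠ≡ : foldr _∩_ (A j ∩ a) (tabulate A) ≡ ⋂ᶠ A
      ⋂ᶠ≡ = trans (foldr-∩ (tabulate A)) (p⊆q⇒p∩q≡p (⊆-∩ (⋂ᶠ-⊆ A j) (⋂ᶠ-⊆ A i)))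
      attained : ∀ {X} → Admissible X → ∃ λ k → X ≐ θ ·∣ A k ∣
      attained (core-sized _ X≐a)     = i , X≐a
      attained (pair-sized j _ _ X≐Aj) = j , X≐Aj

  torPartners-closed : ∀ s → ClosedIntersecting s θ (HasTorPartner G θ)
  torPartners-closed s _ (ℕ.s≤s (ℕ.s≤s _)) _ A A-inj A∈ =
    let i , A-min = argmin-Fin (λ k → ∣ A k ∣) in
    map₂ ≐⁻ (Intersection.⋂ᶠ-attained A (proj₁ ∘ A∈) i A-min (proj₂ (proj₂ (A∈ i)))
                                        (punchIn i zero) (punchInᵢ≢i i zero ∘ A-inj))

3-closed⇒torPartners-closed : ∀ {θ} {G : Subset n → Set} → 0ℚ < θ → θ < 1ℚ →
                              ClosedIntersecting 3 θ G →
                              ∀ s → ClosedIntersecting s θ (HasTorPartner G θ)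
3-closed⇒torPartners-closed {θ = θ} {G} 0<θ θ<1 closed = TorPartners.torPartners-closed 0<θ θ<1
  (closed⇒pairwise {θ = θ} {G = G} (ClosedIntersecting-mono {θ = θ} {G = G} (ℕ.n≤1+n 2) closed))
  (closed⇒triplewise {θ = θ} {G = G} closed)

-- E_nor need not be excluded: only the existence of Tor-partners is used.
InFnor*⇒HasTorPartner : ∀ {𝓕 : Subset n → Bool} {θ A} → InFnor* 𝓕 θ A → HasTorPartner (In 𝓕 θ) θ A
InFnor*⇒HasTorPartner ((A∈𝓕 , _ , allTor) , _) =
  let B , B∈𝓕 , ∣A∣≤∣B∣ , A∩B≐ = allTor _ A∈𝓕 refl in A∈𝓕 , B , B∈𝓕 , ∣A∣≤∣B∣ , ≐⁺ A∩B≐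

proposition2p16 : ∀ (n : ℕ) (𝓕 : Subset n → Bool) (r : ℕ) (θ : ℚ) →
    3 ≤ r → 0ℚ < θ → θ < 1ℚ →
    ClosedIntersecting r θ (λ A → T (𝓕 A)) →
    ∀ (s : ℕ) → 2 ≤ s → ClosedIntersecting s θ (InFnor* 𝓕 θ)
proposition2p16 n 𝓕 r θ 3≤r 0<θ θ<1 closed s _ =
  ClosedIntersecting-⊆ {θ = θ} {G = HasTorPartner (In 𝓕 θ) θ} InFnor*⇒HasTorPartner
    (3-closed⇒torPartners-closed 0<θ θ<1 (ClosedIntersecting-mono {θ = θ} {G = In 𝓕 θ} 3≤r closed) s)
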